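{- For every integer $g \ge 0$ let $n_g$ denote the number of numerical semigroups of genus $g$, and let $(F_i)_{i\ge 0}$ be the Fibonacci sequence with $F_0=0$, $F_1=1$, $F_{i}=F_{i-1}+F_{i-2}$. Then $2F_g \le n_g$ for all $g \ge 2$, and $2F_g \le n_g \le 1 + 3\cdot 2^{g-3}$ for all $g \ge 3$.
   Context: A numerical semigroup is a subset $\Lambda \subseteq \mathbb{N}_0=\{0,1,2,\dots\}$ containing $0$, closed under addition, and with finite complement $\mathbb{N}_0\setminus\Lambda$. The elements of $\mathbb{N}_0\setminus\Lambda$ are the gaps of $\Lambda$, and the genus of $\Lambda$ is the number of gaps $|\mathbb{N}_0\setminus\Lambda|$. -}

module Defs where

open import Data.Nat using (ℕ; zero; suc; _+_; _*_; _≤_; _<_)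
open import Data.Bool using (Bool; true; false)
open import Data.List using (List; length)
open import Data.List.Relation.Unary.All using (All)
open import Data.List.Relation.Unary.Any using (Any)
open import Data.List.Relation.Unary.AllPairs using (AllPairs)
open import Data.Product using (Σ; ∃; _×_)
open import Relation.Binary.PropositionalEquality using (_≡_)
open import Relation.Nullary using (¬_)

fib : ℕ → ℕ
fib zero = zero
fib (suc zero) = suc zero
fib (suc (suc n)) = fib (suc n) + fib n

-- A subset of ℕ₀ given by its characteristic function (membership is
-- decidable for every numerical semigroup, since the complement is finite).
Subset : Set
Subset = ℕ → Bool

_≐_ : Subset → Subset → Set
Λ ≐ Λ' = ∀ n → Λ n ≡ Λ' n

IsNumericalSemigroup : Subset → Set
IsNumericalSemigroup Λ =
  (Λ 0 ≡ true)
  × (∀ a b → Λ a ≡ true → Λ b ≡ true → Λ (a + b) ≡ true)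
  × (∃ λ c → ∀ n → c ≤ n → Λ n ≡ true)

gapsBelow : Subset → ℕ → ℕ
gapsBelow Λ zero = zero
gapsBelow Λ (suc c) with Λ c
... | true  = gapsBelow Λ c
... | false = suc (gapsBelow Λ c)

HasGenus : Subset → ℕ → Set
HasGenus Λ g = ∃ λ c → (∀ n → c ≤ n → Λ n ≡ true) × (gapsBelow Λ c ≡ g)

NumSemigroupOfGenus : ℕ → Subset → Set
NumSemigroupOfGenus g Λ = IsNumericalSemigroup Λ × HasGenus Λ g

-- "There are exactly N numerical semigroups of genus g" (up to extensional
-- equality of subsets): an explicit duplicate-free complete enumeration of
-- length N.
CountOfGenus : ℕ → ℕ → Set
CountOfGenus g N = Σ (List Subset) λ L →
    (length L ≡ N)
  × All (NumSemigroupOfGenus g) L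
  × AllPairs (λ Λ Λ' → ¬ (Λ ≐ Λ')) L
  × (∀ Λ → NumSemigroupOfGenus g Λ → Any (λ Λ' → Λ ≐ Λ') L)

-- Every numerical semigroup of genus g + 1 arises in exactly one way from one of genus g: Λ is
-- obtained from Λ ∪ {f}, f its Frobenius number, by removing a minimal generator that is at
-- least the conductor.  So n_g counts the nodes at depth g of the tree rooted at ℕ₀ whose edges
-- are these removals.  If a node has k children, ordered by the removed generator x, the i-th
-- child keeps the k − 1 − i larger generators and gains at most one new one, x + m (m the
-- multiplicity), unless x = m.  Hence while m is below the conductor, which is inherited by all
-- descendants, the number of depth-d descendants is squeezed between two binomial recurrences.
-- The tree begins with the ordinary semigroups {0} ∪ [c, ∞), whose children are known exactly,
-- and summing the recurrences along antidiagonals gives 2 F_g and 1 + 3 · 2^(g − 3).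
module Submission where

open import Defs
open import Data.Nat using (ℕ; zero; suc; _+_; _*_; _∸_; _^_; _≤_; _<_; _≤′_; ≤′-refl; ≤′-step; z≤n; s≤s; z<s)
open import Data.Nat.Properties
open import Data.Bool using (Bool; true; false)
open import Data.Bool.Properties using (not-¬) renaming (_≟_ to _≟ᵇ_)
open import Data.Product using (Σ; ∃; _×_; _,_; proj₁; proj₂)
open import Data.Sum using (_⊎_; inj₁; inj₂)
open import Data.Empty using (⊥-elim)
open import Data.List using (List; []; _∷_; length; map; concatMap)
open import Data.List.Properties using (length-++; length-map; ++-identityʳ)
open import Data.List.Relation.Unary.All as All using (All; []; _∷_)
import Data.List.Relation.Unary.All.Properties as All
open import Data.List.Relation.Unary.Any as Any using (Any; here; there)
import Data.List.Relation.Unary.Any.Properties as Any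
open import Data.List.Relation.Unary.AllPairs as AllPairs using (AllPairs; []; _∷_)
import Data.List.Relation.Unary.AllPairs.Properties as AllPairs
open import Level using (0ℓ)
open import Relation.Binary.PropositionalEquality
open import Relation.Nullary using (¬_; Dec; yes; no; contradiction)
open import Relation.Nullary.Decidable using (map′; _×-dec_; ¬?)
open import Relation.Unary using (Pred; Decidable)
open import Relation.Binary.Definitions using (tri<; tri≈; tri>)
open import Algebra.Properties.CommutativeSemigroup +-commutativeSemigroup using (interchange)

-- Binomial recurrences and their antidiagonal sums

sumBelow : (ℕ → ℕ) → ℕ → ℕ
sumBelow F zero    = 0
sumBelow F (suc k) = F k + sumBelow F k

sumBelow-mono-≤ : ∀ F {k k'} → k ≤ k' → sumBelow F k ≤ sumBelow F k'
sumBelow-mono-≤ F k≤k' = go (≤⇒≤′ k≤k')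
  where
  go : ∀ {k k'} → k ≤′ k' → sumBelow F k ≤ sumBelow F k'
  go ≤′-refl       = ≤-refl
  go (≤′-step k≤n) = ≤-trans (go k≤n) (m≤n+m _ _)

-- Bounds on the depth-d descendants of a node with k children, the i-th of which has between
-- k − 1 − i and k − i children of its own.
descUB : ℕ → ℕ → ℕ
descUB k zero    = 1
descUB k (suc d) = sumBelow (λ j → descUB (suc j) d) k

descLB : ℕ → ℕ → ℕ
descLB k zero    = 1
descLB k (suc d) = sumBelow (λ j → descLB j d) k

descUB-mono-≤ : ∀ d {k k'} → k ≤ k' → descUB k d ≤ descUB k' d
descUB-mono-≤ zero    _    = ≤-refl
descUB-mono-≤ (suc d) k≤k' = sumBelow-mono-≤ _ k≤k'

descLB-mono-≤ : ∀ d {k k'} → k ≤ k' → descLB k d ≤ descLB k' d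
descLB-mono-≤ zero    _    = ≤-refl
descLB-mono-≤ (suc d) k≤k' = sumBelow-mono-≤ _ k≤k'

antidiagonal : (ℕ → ℕ → ℕ) → ℕ → ℕ
antidiagonal f zero    = f 0 0
antidiagonal f (suc n) = f 0 (suc n) + antidiagonal (λ a b → f (suc a) b) n

antidiagonal-cong : ∀ {f g} → (∀ a b → f a b ≡ g a b) → ∀ n → antidiagonal f n ≡ antidiagonal g n
antidiagonal-cong f≗g zero    = f≗g 0 0
antidiagonal-cong f≗g (suc n) = cong₂ _+_ (f≗g 0 (suc n)) (antidiagonal-cong (λ a → f≗g (suc a)) n)

antidiagonal-+ : ∀ f g n →
  antidiagonal (λ a b → f a b + g a b) n ≡ antidiagonal f n + antidiagonal g n
antidiagonal-+ f g zero    = refl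
antidiagonal-+ f g (suc n) =
  trans (cong (f 0 (suc n) + g 0 (suc n) +_) (antidiagonal-+ (λ a → f (suc a)) (λ a → g (suc a)) n))
        (interchange (f 0 (suc n)) (g 0 (suc n)) _ _)

antidiagonal-last : ∀ f n → antidiagonal f (suc n) ≡ antidiagonal (λ a b → f a (suc b)) n + f (suc n) 0
antidiagonal-last f zero    = refl
antidiagonal-last f (suc n) =
  trans (cong (f 0 (suc (suc n)) +_) (antidiagonal-last (λ a → f (suc a)) n))
        (sym (+-assoc (f 0 (suc (suc n))) _ _))

-- Depth-d descendants of the ordinary semigroup of genus h + 1: its first child is ordinary of
-- genus h + 2, and V h d accounts for the others.
ordinaryDesc : (ℕ → ℕ → ℕ) → ℕ → ℕ → ℕ
ordinaryDesc V h zero    = 1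
ordinaryDesc V h (suc d) = ordinaryDesc V (suc h) d + V h d

ordinaryDesc-antidiagonal : ∀ V h d → ordinaryDesc V h (suc d) ≡ 1 + antidiagonal (λ i → V (h + i)) d
ordinaryDesc-antidiagonal V h zero    = cong (λ z → 1 + V z 0) (sym (+-identityʳ h))
ordinaryDesc-antidiagonal V h (suc d) = begin
    ordinaryDesc V (suc h) (suc d) + V h (suc d)
  ≡⟨ cong (_+ V h (suc d)) (ordinaryDesc-antidiagonal V (suc h) d) ⟩
    1 + antidiagonal (λ i → V (suc h + i)) d + V h (suc d)
  ≡⟨ cong suc (+-comm (antidiagonal (λ i → V (suc h + i)) d) (V h (suc d))) ⟩
    1 + (V h (suc d) + antidiagonal (λ i → V (suc h + i)) d)
  ≡⟨ cong₂ (λ u w → 1 + (V u (suc d) + w)) (sym (+-identityʳ h))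
       (antidiagonal-cong (λ a b → cong (λ z → V z b) (sym (+-suc h a))) d) ⟩
    1 + (V (h + 0) (suc d) + antidiagonal (λ i → V (h + suc i)) d) ∎
  where open ≡-Reasoning

-- With c = h + 2, the child c + 1 has h + 1 children and c + 2, …, 2c − 1 have h − 1, …, 0.
ordinaryStepUB : ℕ → ℕ → ℕ
ordinaryStepUB h d = descUB (suc h) d + sumBelow (λ j → descUB j d) h

ordinaryStepLB : ℕ → ℕ → ℕ
ordinaryStepLB h d = descLB (suc h) d + sumBelow (λ j → descLB j d) h

-- descUB (a + 1) b is the binomial coefficient C(a + b, b), so the antidiagonals are the rows
-- of Pascal's triangle.
antidiagonal-descUB : ∀ n → antidiagonal (λ a → descUB (suc a)) n ≡ 2 ^ n
antidiagonal-descUB zero    = refl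
antidiagonal-descUB (suc n) = begin
    antidiagonal (λ a → descUB (suc a)) (suc n)
  ≡⟨ antidiagonal-last (λ a → descUB (suc a)) n ⟩
    antidiagonal (λ a b → descUB (suc a) b + descUB a (suc b)) n + 1
  ≡⟨ cong (_+ 1) (antidiagonal-+ (λ a → descUB (suc a)) (λ a b → descUB a (suc b)) n) ⟩
    R + X + 1
  ≡⟨ +-assoc R X 1 ⟩
    R + (X + 1)
  ≡⟨ cong (R +_) (shifted n) ⟩
    R + R
  ≡⟨ cong₂ _+_ (antidiagonal-descUB n) (trans (antidiagonal-descUB n) (sym (+-identityʳ _))) ⟩
    2 ^ n + (2 ^ n + 0) ∎
  where
  open ≡-Reasoning
  R = antidiagonal (λ a → descUB (suc a)) n
  X = antidiagonal (λ a b → descUB a (suc b)) n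
  shifted : ∀ n → antidiagonal (λ a b → descUB a (suc b)) n + 1 ≡ antidiagonal (λ a → descUB (suc a)) n
  shifted zero    = refl
  shifted (suc n) = sym (antidiagonal-last (λ a → descUB (suc a)) n)

antidiagonal-sumBelow-descUB : ∀ m → antidiagonal (λ a b → sumBelow (λ j → descUB j b) a) (suc m) ≡ 2 ^ m
antidiagonal-sumBelow-descUB zero    = refl
antidiagonal-sumBelow-descUB (suc m) = begin
    antidiagonal (λ a b → descUB a b + sumBelow (λ j → descUB j b) a) (suc m)
  ≡⟨ antidiagonal-+ descUB (λ a b → sumBelow (λ j → descUB j b) a) (suc m) ⟩
    antidiagonal (λ a → descUB (suc a)) m + antidiagonal (λ a b → sumBelow (λ j → descUB j b) a) (suc m)
  ≡⟨ cong₂ _+_ (antidiagonal-descUB m) (antidiagonal-sumBelow-descUB m) ⟩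
    2 ^ m + 2 ^ m
  ≡⟨ cong (2 ^ m +_) (sym (+-identityʳ (2 ^ m))) ⟩
    2 ^ suc m ∎
  where open ≡-Reasoning

ordinaryDescUB-closed : ∀ m → ordinaryDesc ordinaryStepUB 0 (suc (suc m)) ≡ 1 + 3 * 2 ^ m
ordinaryDescUB-closed m = begin
    ordinaryDesc ordinaryStepUB 0 (suc (suc m))
  ≡⟨ ordinaryDesc-antidiagonal ordinaryStepUB 0 (suc m) ⟩
    1 + antidiagonal ordinaryStepUB (suc m)
  ≡⟨ cong suc (antidiagonal-+ (λ a → descUB (suc a)) (λ a b → sumBelow (λ j → descUB j b) a) (suc m)) ⟩
    1 + (antidiagonal (λ a → descUB (suc a)) (suc m) + antidiagonal (λ a b → sumBelow (λ j → descUB j b) a) (suc m))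
  ≡⟨ cong (λ z → 1 + z) (cong₂ _+_ (antidiagonal-descUB (suc m)) (antidiagonal-sumBelow-descUB m)) ⟩
    1 + (2 * 2 ^ m + 2 ^ m)
  ≡⟨ cong suc (+-comm (2 * 2 ^ m) (2 ^ m)) ⟩
    1 + 3 * 2 ^ m ∎
  where open ≡-Reasoning

-- descLB a b is the binomial coefficient C(a, b), whose antidiagonal sums are Fibonacci numbers.
antidiagonal-descLB : ∀ n → antidiagonal descLB n ≡ fib (suc n)
antidiagonal-descLB zero          = refl
antidiagonal-descLB (suc zero)    = refl
antidiagonal-descLB (suc (suc n)) = begin
    antidiagonal (λ a → descLB (suc a)) (suc n)
  ≡⟨ antidiagonal-last (λ a → descLB (suc a)) n ⟩
    antidiagonal (λ a b → descLB a b + descLB a (suc b)) n + 1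
  ≡⟨ cong (_+ 1) (antidiagonal-+ descLB (λ a b → descLB a (suc b)) n) ⟩
    antidiagonal descLB n + X + 1
  ≡⟨ trans (+-assoc (antidiagonal descLB n) X 1) (+-comm (antidiagonal descLB n) (X + 1)) ⟩
    X + 1 + antidiagonal descLB n
  ≡⟨ cong (_+ antidiagonal descLB n) (sym (antidiagonal-last descLB n)) ⟩
    antidiagonal descLB (suc n) + antidiagonal descLB n
  ≡⟨ cong₂ _+_ (antidiagonal-descLB (suc n)) (antidiagonal-descLB n) ⟩
    fib (suc (suc n)) + fib (suc n) ∎
  where
  open ≡-Reasoning
  X = antidiagonal (λ a b → descLB a (suc b)) n

ordinaryDescLB-closed : ∀ n → ordinaryDesc ordinaryStepLB 0 (suc n) ≡ 2 * fib (suc (suc n))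
ordinaryDescLB-closed n = begin
    ordinaryDesc ordinaryStepLB 0 (suc n)
  ≡⟨ ordinaryDesc-antidiagonal ordinaryStepLB 0 n ⟩
    1 + antidiagonal ordinaryStepLB n
  ≡⟨ cong suc (antidiagonal-+ (λ a → descLB (suc a)) (λ a b → descLB a (suc b)) n) ⟩
    1 + (antidiagonal descLB (suc n) + X)
  ≡⟨ cong suc (+-comm (antidiagonal descLB (suc n)) X) ⟩
    1 + (X + antidiagonal descLB (suc n))
  ≡⟨ cong (_+ antidiagonal descLB (suc n)) (trans (+-comm 1 X) (sym (antidiagonal-last descLB n))) ⟩
    antidiagonal descLB (suc n) + antidiagonal descLB (suc n)
  ≡⟨ cong₂ _+_ (antidiagonal-descLB (suc n)) (trans (antidiagonal-descLB (suc n)) (sym (+-identityʳ _))) ⟩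
    2 * fib (suc (suc n)) ∎
  where
  open ≡-Reasoning
  X = antidiagonal (λ a b → descLB a (suc b)) n

-- Counting and summing over a window [a, a + n) of ℕ

count : {P : Pred ℕ 0ℓ} → Decidable P → ℕ → ℕ → ℕ
count P? a zero    = 0
count P? a (suc n) with P? a
... | yes _ = suc (count P? (suc a) n)
... | no  _ = count P? (suc a) n

sumWhere : {P : Pred ℕ 0ℓ} → Decidable P → ℕ → ℕ → (ℕ → ℕ) → ℕ
sumWhere P? a zero    F = 0
sumWhere P? a (suc n) F with P? a
... | yes _ = F a + sumWhere P? (suc a) n F
... | no  _ = sumWhere P? (suc a) n F

above-suc : ∀ {R : ℕ → Set} {a} → (∀ y → a ≤ y → R y) → ∀ y → suc a ≤ y → R y
above-suc R y a<y = R y (<⇒≤ a<y)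

module _ {P : Pred ℕ 0ℓ} (P? : Decidable P) where

  sumWhere-yes : ∀ {a} n F → P a → sumWhere P? a (suc n) F ≡ F a + sumWhere P? (suc a) n F
  sumWhere-yes {a} n F Pa with P? a
  ... | yes _  = refl
  ... | no ¬Pa = contradiction Pa ¬Pa

  sumWhere-mono-≤ : ∀ {F G} a n → (∀ x → a ≤ x → P x → F x ≤ G x) → sumWhere P? a n F ≤ sumWhere P? a n G
  sumWhere-mono-≤ a zero    F≤G = z≤n
  sumWhere-mono-≤ a (suc n) F≤G with P? a
  ... | yes Pa = +-mono-≤ (F≤G a ≤-refl Pa) (sumWhere-mono-≤ (suc a) n (above-suc F≤G))
  ... | no  _  = sumWhere-mono-≤ (suc a) n (above-suc F≤G)

  -- Each x is weighted by the number of later points, so the weights run through 0, 1, …, count − 1.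
  sumWhere-count : ∀ G a n →
    sumWhere P? a n (λ x → G (count P? (suc x) (a + n ∸ suc x))) ≡ sumBelow G (count P? a n)
  sumWhere-count G a n = go a n refl
    where
    go : ∀ {E} a n → a + n ≡ E →
         sumWhere P? a n (λ x → G (count P? (suc x) (E ∸ suc x))) ≡ sumBelow G (count P? a n)
    go a zero    _    = refl
    go a (suc n) refl with P? a
    ... | yes _ = cong₂ _+_ (cong (λ m → G (count P? (suc a) m)) (trans (cong (_∸ suc a) (+-suc a n)) (m+n∸m≡n a n)))
                            (go (suc a) n (sym (+-suc a n)))
    ... | no  _ = go (suc a) n (sym (+-suc a n))

  sumWhere≤sumBelow : ∀ {F G} a n → (∀ x → a ≤ x → P x → F x ≤ G (count P? (suc x) (a + n ∸ suc x))) →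
                      sumWhere P? a n F ≤ sumBelow G (count P? a n)
  sumWhere≤sumBelow {G = G} a n F≤G = ≤-trans (sumWhere-mono-≤ a n F≤G) (≤-reflexive (sumWhere-count G a n))

  sumBelow≤sumWhere : ∀ {F G} a n → (∀ x → a ≤ x → P x → G (count P? (suc x) (a + n ∸ suc x)) ≤ F x) →
                      sumBelow G (count P? a n) ≤ sumWhere P? a n F
  sumBelow≤sumWhere {G = G} a n G≤F = ≤-trans (≤-reflexive (sym (sumWhere-count G a n))) (sumWhere-mono-≤ a n G≤F)

  count-cut : ∀ a {m n} → (∀ y → a + m ≤ y → ¬ P y) → m ≤ n → count P? a n ≡ count P? a m
  count-cut a {zero}  {zero}  _    _         = refl
  count-cut a {zero}  {suc n} ¬P   _         with P? a
  ... | yes Pa = contradiction Pa (¬P a (≤-reflexive (+-identityʳ a)))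
  ... | no  _  = count-cut (suc a) {n = n} (λ y le → ¬P y (≤-trans (n≤1+n _) le)) z≤n
  count-cut a {suc m} {suc n} ¬P   (s≤s m≤n) with P? a
  ... | yes _ = cong suc (count-cut (suc a) (λ y le → ¬P y (≤-trans (≤-reflexive (+-suc a m)) le)) m≤n)
  ... | no  _ = count-cut (suc a) (λ y le → ¬P y (≤-trans (≤-reflexive (+-suc a m)) le)) m≤n

  count-all : ∀ a m → (∀ y → a ≤ y → y < a + m → P y) → count P? a m ≡ m
  count-all a zero    _  = refl
  count-all a (suc m) Py with P? a
  ... | yes _  = cong suc (count-all (suc a) m (λ y a<y y< → Py y (<⇒≤ a<y) (≤-trans y< (≤-reflexive (sym (+-suc a m))))))
  ... | no ¬Pa = contradiction (Py a ≤-refl (≤-trans (s≤s (m≤m+n a m)) (≤-reflexive (sym (+-suc a m))))) ¬Pa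

module _ {P Q : Pred ℕ 0ℓ} (P? : Decidable P) (Q? : Decidable Q) where

  count-mono-≤ : ∀ a n → (∀ y → a ≤ y → P y → Q y) → count P? a n ≤ count Q? a n
  count-mono-≤ a zero    P⇒Q = z≤n
  count-mono-≤ a (suc n) P⇒Q with P? a | Q? a
  ... | yes _  | yes _  = s≤s (count-mono-≤ (suc a) n (above-suc P⇒Q))
  ... | yes Pa | no ¬Qa = contradiction (P⇒Q a ≤-refl Pa) ¬Qa
  ... | no  _  | yes _  = m≤n⇒m≤1+n (count-mono-≤ (suc a) n (above-suc P⇒Q))
  ... | no  _  | no  _  = count-mono-≤ (suc a) n (above-suc P⇒Q)

  count-≤-suc : ∀ k a n → (∀ y → a ≤ y → P y → Q y ⊎ y ≡ k) → count P? a n ≤ suc (count Q? a n)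
  count-≤-suc k a zero    P⇒Q∨k = z≤n
  count-≤-suc k a (suc n) P⇒Q∨k with P? a | Q? a
  ... | yes _  | yes _  = s≤s (count-≤-suc k (suc a) n (above-suc P⇒Q∨k))
  ... | no  _  | yes _  = m≤n⇒m≤1+n (count-≤-suc k (suc a) n (above-suc P⇒Q∨k))
  ... | no  _  | no  _  = count-≤-suc k (suc a) n (above-suc P⇒Q∨k)
  ... | yes Pa | no ¬Qa with P⇒Q∨k a ≤-refl Pa
  ...   | inj₁ Qa  = contradiction Qa ¬Qa
  ...   | inj₂ refl = s≤s (count-mono-≤ (suc a) n P⇒Q)
    where
    P⇒Q : ∀ y → suc a ≤ y → P y → Q y
    P⇒Q y a<y Py with P⇒Q∨k y (<⇒≤ a<y) Py
    ... | inj₁ Qy   = Qy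
    ... | inj₂ refl = contradiction refl (<⇒≢ a<y)

  count-suc-< : ∀ {a n} → (P a → Q a) → count P? (suc a) n < count Q? (suc a) n → count P? a (suc n) < count Q? a (suc n)
  count-suc-< {a} Pa⇒Qa lt with P? a | Q? a
  ... | yes _  | yes _  = s≤s lt
  ... | yes Pa | no ¬Qa = contradiction (Pa⇒Qa Pa) ¬Qa
  ... | no  _  | yes _  = m≤n⇒m≤1+n lt
  ... | no  _  | no  _  = lt

  count-<-witness : ∀ k a n → (∀ y → a ≤ y → P y → Q y) → a ≤ k → k < a + n → ¬ P k → Q k →
                    count P? a n < count Q? a n
  count-<-witness k a zero    _   a≤k k<a+0 _ _ = contradiction (≤-trans k<a+0 (≤-reflexive (+-identityʳ a))) (≤⇒≯ a≤k)
  count-<-witness k a (suc n) P⇒Q a≤k k<a+n ¬Pk Qk with m≤n⇒m<n∨m≡n a≤k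
  ... | inj₁ a<k  = count-suc-< (P⇒Q a ≤-refl)
                      (count-<-witness k (suc a) n (above-suc P⇒Q) a<k (subst (k <_) (+-suc a n) k<a+n) ¬Pk Qk)
  ... | inj₂ refl with P? a | Q? a
  ...   | no  _  | yes _  = s≤s (count-mono-≤ (suc a) n (above-suc P⇒Q))
  ...   | yes Pk | _      = contradiction Pk ¬Pk
  ...   | _      | no ¬Qk = contradiction Qk ¬Qk

-- Subsets, generators and numerical semigroups

infix 4 _∈_ _∉_

_∈_ : ℕ → Subset → Set
n ∈ Λ = Λ n ≡ true

_∉_ : ℕ → Subset → Set
n ∉ Λ = Λ n ≡ false

∈⇒¬∉ : ∀ {b : Bool} → b ≡ true → ¬ b ≡ false
∈⇒¬∉ = not-¬

-- Abstract because the unfolded remove Λ x n is a stuck with-term, from which Agda cannot infer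
-- Λ and x.
abstract
  remove : Subset → ℕ → Subset
  remove Λ x n with n ≟ x
  ... | yes _ = false
  ... | no  _ = Λ n

  insert : Subset → ℕ → Subset
  insert Λ x n with n ≟ x
  ... | yes _ = true
  ... | no  _ = Λ n

  x∉remove : ∀ {Λ x} → x ∉ remove Λ x
  x∉remove {x = x} with x ≟ x
  ... | yes _   = refl
  ... | no  x≢x = contradiction refl x≢x

  remove-≢ : ∀ {Λ x n} → n ≢ x → remove Λ x n ≡ Λ n
  remove-≢ {x = x} {n} n≢x with n ≟ x
  ... | yes n≡x = contradiction n≡x n≢x
  ... | no  _   = refl

  ∈-remove⁻ : ∀ {Λ x n} → n ∈ remove Λ x → n ∈ Λ × n ≢ x
  ∈-remove⁻ {x = x} {n} n∈ with n ≟ x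
  ... | no n≢x = n∈ , n≢x

  x∈insert : ∀ {Λ x} → x ∈ insert Λ x
  x∈insert {x = x} with x ≟ x
  ... | yes _   = refl
  ... | no  x≢x = contradiction refl x≢x

  insert-≢ : ∀ {Λ x n} → n ≢ x → insert Λ x n ≡ Λ n
  insert-≢ {x = x} {n} n≢x with n ≟ x
  ... | yes n≡x = contradiction n≡x n≢x
  ... | no  _   = refl

record Decomposition (Λ : Subset) (x : ℕ) : Set where
  constructor decomposition
  field
    {a b} : ℕ
    0<a   : 0 < a
    0<b   : 0 < b
    a∈Λ   : a ∈ Λ
    b∈Λ   : b ∈ Λ
    a+b≡x : a + b ≡ x

Generator : Subset → ℕ → Set
Generator Λ x = 0 < x × x ∈ Λ × ¬ Decomposition Λ x

decomposition? : ∀ Λ x → Dec (Decomposition Λ x)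
decomposition? Λ x = map′ from to (anyUpTo? (λ a → 0 <? a ×-dec Λ a ≟ᵇ true ×-dec Λ (x ∸ a) ≟ᵇ true) x)
  where
  from : (∃ λ a → a < x × 0 < a × a ∈ Λ × x ∸ a ∈ Λ) → Decomposition Λ x
  from (a , a<x , 0<a , a∈Λ , x-a∈Λ) = decomposition 0<a (m<n⇒0<n∸m a<x) a∈Λ x-a∈Λ (m+[n∸m]≡n (<⇒≤ a<x))
  to : Decomposition Λ x → ∃ λ a → a < x × 0 < a × a ∈ Λ × x ∸ a ∈ Λ
  to (decomposition {a} {b} 0<a 0<b a∈Λ b∈Λ refl) =
    a , m<m+n a 0<b , 0<a , a∈Λ , subst (_∈ Λ) (sym (m+n∸m≡n a b)) b∈Λ

generator? : ∀ Λ → Decidable (Generator Λ)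
generator? Λ x = 0 <? x ×-dec Λ x ≟ᵇ true ×-dec ¬? (decomposition? Λ x)

record NumSemigroup (Λ : Subset) (c : ℕ) : Set where
  field
    0∈       : 0 ∈ Λ
    +-closed : ∀ {a b} → a ∈ Λ → b ∈ Λ → a + b ∈ Λ
    ≥c⇒∈     : ∀ {n} → c ≤ n → n ∈ Λ
    c-least  : c ≡ 0 ⊎ ∃ λ f → c ≡ suc f × f ∉ Λ

open NumSemigroup

remove-generator : ∀ {Λ c x} → NumSemigroup Λ c → c ≤ x → Generator Λ x → NumSemigroup (remove Λ x) (suc x)
remove-generator {Λ} {c} {x} S c≤x (0<x , _ , indecomposable) = record
  { 0∈       = trans (remove-≢ (λ 0≡x → <⇒≢ 0<x 0≡x)) (0∈ S)
  ; +-closed = λ {a} {b} → closed {a} {b}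
  ; ≥c⇒∈     = λ x<n → trans (remove-≢ (λ n≡x → <⇒≢ x<n (sym n≡x))) (≥c⇒∈ S (≤-trans c≤x (<⇒≤ x<n)))
  ; c-least  = inj₂ (x , refl , x∉remove)
  }
  where
  closed : ∀ {a b} → a ∈ remove Λ x → b ∈ remove Λ x → a + b ∈ remove Λ x
  closed {a} {b} a∈ b∈ with ∈-remove⁻ a∈ | ∈-remove⁻ b∈
  ... | a∈Λ , a≢x | b∈Λ , b≢x = trans (remove-≢ a+b≢x) (+-closed S a∈Λ b∈Λ)
    where
    a+b≢x : a + b ≢ x
    a+b≢x a+b≡x = indecomposable (decomposition 0<a 0<b a∈Λ b∈Λ a+b≡x)
      where
      0<a = n≢0⇒n>0 (λ a≡0 → b≢x (trans (cong (_+ b) (sym a≡0)) a+b≡x))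
      0<b = n≢0⇒n>0 (λ b≡0 → a≢x (trans (trans (sym (+-identityʳ a)) (cong (a +_) (sym b≡0))) a+b≡x))

gapsBelow-∉ : ∀ Λ n → n ∉ Λ → gapsBelow Λ (suc n) ≡ suc (gapsBelow Λ n)
gapsBelow-∉ Λ n n∉Λ rewrite n∉Λ = refl

gapsBelow-∈ : ∀ Λ n → n ∈ Λ → gapsBelow Λ (suc n) ≡ gapsBelow Λ n
gapsBelow-∈ Λ n n∈Λ rewrite n∈Λ = refl

gapsBelow-cong : ∀ {Λ Λ'} c → (∀ {n} → n < c → Λ n ≡ Λ' n) → gapsBelow Λ c ≡ gapsBelow Λ' c
gapsBelow-cong zero    _    = refl
gapsBelow-cong {Λ} {Λ'} (suc c) Λ≗Λ' with Λ c | Λ' c | Λ≗Λ' ≤-refl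
... | true  | true  | _ = gapsBelow-cong c (λ n<c → Λ≗Λ' (m<n⇒m<1+n n<c))
... | false | false | _ = cong suc (gapsBelow-cong c (λ n<c → Λ≗Λ' (m<n⇒m<1+n n<c)))

gapsBelow-full : ∀ {Λ c x} → (∀ {n} → c ≤ n → n ∈ Λ) → c ≤ x → gapsBelow Λ x ≡ gapsBelow Λ c
gapsBelow-full {x = zero}  _   z≤n = refl
gapsBelow-full {c = c} {suc x} ≥c⇒∈ c≤1+x with m≤n⇒m<n∨m≡n c≤1+x
... | inj₁ c<1+x = trans (gapsBelow-∈ _ x (≥c⇒∈ (≤-pred c<1+x))) (gapsBelow-full ≥c⇒∈ (≤-pred c<1+x))
... | inj₂ refl = refl

genus-remove : ∀ {Λ c x} → NumSemigroup Λ c → c ≤ x → gapsBelow (remove Λ x) (suc x) ≡ suc (gapsBelow Λ c)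
genus-remove {Λ} {c} {x} S c≤x = begin
    gapsBelow (remove Λ x) (suc x) ≡⟨ gapsBelow-∉ (remove Λ x) x x∉remove ⟩
    suc (gapsBelow (remove Λ x) x) ≡⟨ cong suc (gapsBelow-cong x (λ n<x → remove-≢ (<⇒≢ n<x))) ⟩
    suc (gapsBelow Λ x)            ≡⟨ cong suc (gapsBelow-full (≥c⇒∈ S) c≤x) ⟩
    suc (gapsBelow Λ c)            ∎
  where open ≡-Reasoning

gapsBelow≡0⇒∈ : ∀ {Λ} c → gapsBelow Λ c ≡ 0 → ∀ {n} → n < c → n ∈ Λ
gapsBelow≡0⇒∈ {Λ} (suc c) no-gaps {n} n<1+c with Λ c in Λc | m≤n⇒m<n∨m≡n (≤-pred n<1+c)
... | true | inj₁ n<c  = gapsBelow≡0⇒∈ c no-gaps n<c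
... | true | inj₂ refl = Λc

frobenius : ∀ {Λ c g} → (∀ {n} → c ≤ n → n ∈ Λ) → gapsBelow Λ c ≡ suc g →
            ∃ λ f → f ∉ Λ × (∀ {n} → f < n → n ∈ Λ) × gapsBelow Λ f ≡ g
frobenius {Λ} {suc c} ≥c⇒∈ gaps with Λ c in Λc
... | false = c , Λc , ≥c⇒∈ , suc-injective gaps
... | true  = frobenius ≥c⇒∈' gaps
  where
  ≥c⇒∈' : ∀ {n} → c ≤ n → n ∈ Λ
  ≥c⇒∈' c≤n with m≤n⇒m<n∨m≡n c≤n
  ... | inj₁ c<n  = ≥c⇒∈ c<n
  ... | inj₂ refl = Λc

generator< : ∀ {Λ c y} → NumSemigroup Λ c → Generator Λ y → y < c + suc (suc c)
generator< {c = c} {y} S (_ , _ , indecomposable) with y <? c + suc (suc c)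
... | yes y<2c+2 = y<2c+2
... | no  y≮2c+2 = contradiction (decomposition z<s (<-≤-trans z<s c<y-c-1) (≥c⇒∈ S (n≤1+n c)) (≥c⇒∈ S (<⇒≤ c<y-c-1))
                                   (m+[n∸m]≡n (≤-trans (m≤m+n (suc c) (suc c)) 2c+2≤y)))
                                 indecomposable
  where
  2c+2≤y : suc c + suc c ≤ y
  2c+2≤y = subst (_≤ y) (+-suc c (suc c)) (≮⇒≥ y≮2c+2)
  c<y-c-1 : c < y ∸ suc c
  c<y-c-1 = subst (_≤ y ∸ suc c) (m+n∸m≡n (suc c) (suc c)) (∸-monoˡ-≤ (suc c) 2c+2≤y)

generator-remove : ∀ {Λ x y} → Generator Λ y → y ≢ x → Generator (remove Λ x) y
generator-remove (0<y , y∈Λ , indecomposable) y≢x =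
  0<y , trans (remove-≢ y≢x) y∈Λ ,
  λ (decomposition 0<a 0<b a∈ b∈ a+b≡y) →
    indecomposable (decomposition 0<a 0<b (proj₁ (∈-remove⁻ a∈)) (proj₁ (∈-remove⁻ b∈)) a+b≡y)

Multiplicity : Subset → ℕ → Set
Multiplicity Λ m = 0 < m × m ∈ Λ × (∀ {n} → 0 < n → n ∈ Λ → m ≤ n)

multiplicity-remove : ∀ {Λ m x} → Multiplicity Λ m → m ≢ x → Multiplicity (remove Λ x) m
multiplicity-remove (0<m , m∈Λ , m-least) m≢x =
  0<m , trans (remove-≢ m≢x) m∈Λ , λ 0<n n∈ → m-least 0<n (proj₁ (∈-remove⁻ n∈))

¬generator⇒decomposition : ∀ {Λ y} → 0 < y → y ∈ Λ → ¬ Generator Λ y → Decomposition Λ y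
¬generator⇒decomposition {Λ} {y} 0<y y∈Λ ¬gen with decomposition? Λ y
... | yes d = d
... | no ¬d = contradiction (0<y , y∈Λ , ¬d) ¬gen

-- The decomposition uses x, and its other summand is m: otherwise y = m + (y − m) would
-- decompose y in Λ ∖ {x}.
decomposition-through-x : ∀ {Λ c m x y} → NumSemigroup Λ c → c ≤ x → Multiplicity Λ m → m ≢ x →
                          ¬ Decomposition (remove Λ x) y → Decomposition Λ y → y ≡ x + m
decomposition-through-x {Λ} {c} {m} {x} {y} S c≤x (0<m , m∈Λ , m-least) m≢x indecomposable
                        (decomposition {a} {b} 0<a 0<b a∈Λ b∈Λ a+b≡y) = through-x (a ≟ x) (b ≟ x)
  where
  other-summand : ∀ {b} → 0 < b → b ∈ Λ → x + b ≡ y → y ≡ x + m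
  other-summand {b} 0<b b∈Λ x+b≡y with b ≟ m
  ... | yes b≡m = trans (sym x+b≡y) (cong (x +_) b≡m)
  ... | no  b≢m = contradiction (decomposition 0<m (<-≤-trans z<s x<y-m) m∈' y-m∈' (m+[n∸m]≡n m≤y)) indecomposable
    where
    m<b : m < b
    m<b = ≤∧≢⇒< (m-least 0<b b∈Λ) (λ m≡b → b≢m (sym m≡b))
    m≤y : m ≤ y
    m≤y = ≤-trans (<⇒≤ m<b) (subst (b ≤_) x+b≡y (m≤n+m b x))
    x<y-m : x < y ∸ m
    x<y-m = subst (x <_) (sym (trans (cong (_∸ m) (sym x+b≡y)) (+-∸-assoc x (<⇒≤ m<b)))) (m<m+n x (m<n⇒0<n∸m m<b))
    m∈' : m ∈ remove Λ x
    m∈' = trans (remove-≢ m≢x) m∈Λ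
    y-m∈' : y ∸ m ∈ remove Λ x
    y-m∈' = trans (remove-≢ (λ y-m≡x → <⇒≢ x<y-m (sym y-m≡x))) (≥c⇒∈ S (≤-trans c≤x (<⇒≤ x<y-m)))
  through-x : Dec (a ≡ x) → Dec (b ≡ x) → y ≡ x + m
  through-x (yes a≡x) _         = other-summand 0<b b∈Λ (subst (λ z → z + b ≡ y) a≡x a+b≡y)
  through-x (no  _)   (yes b≡x) = other-summand 0<a a∈Λ (subst (λ z → z + a ≡ y) b≡x (trans (+-comm b a) a+b≡y))
  through-x (no  a≢x) (no  b≢x) =
    contradiction (decomposition 0<a 0<b (trans (remove-≢ a≢x) a∈Λ) (trans (remove-≢ b≢x) b∈Λ) a+b≡y) indecomposable

generator-of-remove : ∀ {Λ c m x y} → NumSemigroup Λ c → c ≤ x → Multiplicity Λ m → m ≢ x →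
                      Generator (remove Λ x) y → Generator Λ y ⊎ y ≡ x + m
generator-of-remove {Λ} {y = y} S c≤x M m≢x (0<y , y∈' , indecomposable) with generator? Λ y
... | yes gen = inj₁ gen
... | no ¬gen = inj₂ (decomposition-through-x S c≤x M m≢x indecomposable
                       (¬generator⇒decomposition 0<y (proj₁ (∈-remove⁻ y∈')) ¬gen))

-- The semigroup tree

-- a numerical semigroup paired with its conductor
Node : Set
Node = Subset × ℕ

childrenFrom : Subset → ℕ → ℕ → List Node
childrenFrom Λ a zero    = []
childrenFrom Λ a (suc n) with generator? Λ a
... | yes _ = (remove Λ a , suc a) ∷ childrenFrom Λ (suc a) n
... | no  _ = childrenFrom Λ (suc a) n

-- The children of Λ are the Λ ∖ {x} for the generators x ≥ c, all of which are below 2c + 2.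
children : Node → List Node
children (Λ , c) = childrenFrom Λ c (suc (suc c))

descendants : ℕ → Node → List Node
descendants zero    v = v ∷ []
descendants (suc d) v = concatMap (descendants d) (children v)

#generators≥ : Subset → ℕ → ℕ
#generators≥ Λ c = count (generator? Λ) c (suc (suc c))

data IsChild (Λ : Subset) (a : ℕ) : Node → Set where
  child : ∀ {x} → a ≤ x → Generator Λ x → IsChild Λ a (remove Λ x , suc x)

data Siblings (Λ : Subset) : Node → Node → Set where
  siblings : ∀ {x₁ x₂} → x₁ < x₂ → Generator Λ x₁ →
             Siblings Λ (remove Λ x₁ , suc x₁) (remove Λ x₂ , suc x₂)

IsChild-weaken : ∀ {Λ a w} → IsChild Λ (suc a) w → IsChild Λ a w
IsChild-weaken (child a<x gen) = child (<⇒≤ a<x) gen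

childrenFrom-IsChild : ∀ Λ a n → All (IsChild Λ a) (childrenFrom Λ a n)
childrenFrom-IsChild Λ a zero    = []
childrenFrom-IsChild Λ a (suc n) with generator? Λ a
... | yes gen = child ≤-refl gen ∷ All.map IsChild-weaken (childrenFrom-IsChild Λ (suc a) n)
... | no  _   = All.map IsChild-weaken (childrenFrom-IsChild Λ (suc a) n)

childrenFrom-Siblings : ∀ Λ a n → AllPairs (Siblings Λ) (childrenFrom Λ a n)
childrenFrom-Siblings Λ a zero    = []
childrenFrom-Siblings Λ a (suc n) with generator? Λ a
... | yes gen = All.map later (childrenFrom-IsChild Λ (suc a) n) ∷ childrenFrom-Siblings Λ (suc a) n
  where
  later : ∀ {w} → IsChild Λ (suc a) w → Siblings Λ (remove Λ a , suc a) w
  later (child a<x _) = siblings a<x gen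
... | no  _   = childrenFrom-Siblings Λ (suc a) n

childrenFrom-complete : ∀ Λ a n {x} → a ≤ x → x < a + n → Generator Λ x →
                        Any (_≡ (remove Λ x , suc x)) (childrenFrom Λ a n)
childrenFrom-complete Λ a zero    a≤x x<a+0 _ = contradiction (≤-trans x<a+0 (≤-reflexive (+-identityʳ a))) (≤⇒≯ a≤x)
childrenFrom-complete Λ a (suc n) {x} a≤x x<a+n gen with m≤n⇒m<n∨m≡n a≤x | generator? Λ a
... | inj₂ refl | yes _   = here refl
... | inj₂ refl | no ¬gen = contradiction gen ¬gen
... | inj₁ a<x  | yes _   = there (childrenFrom-complete Λ (suc a) n a<x (subst (x <_) (+-suc a n) x<a+n) gen)
... | inj₁ a<x  | no  _   = childrenFrom-complete Λ (suc a) n a<x (subst (x <_) (+-suc a n) x<a+n) gen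

length-concatMap-childrenFrom : ∀ (f : Node → List Node) Λ a n →
  length (concatMap f (childrenFrom Λ a n)) ≡ sumWhere (generator? Λ) a n (λ x → length (f (remove Λ x , suc x)))
length-concatMap-childrenFrom f Λ a zero    = refl
length-concatMap-childrenFrom f Λ a (suc n) with generator? Λ a
... | yes _ = trans (length-++ (f (remove Λ a , suc a))) (cong (_ +_) (length-concatMap-childrenFrom f Λ (suc a) n))
... | no  _ = length-concatMap-childrenFrom f Λ (suc a) n

#descendants-suc : ∀ d Λ c → length (descendants (suc d) (Λ , c)) ≡
  sumWhere (generator? Λ) c (suc (suc c)) (λ x → length (descendants d (remove Λ x , suc x)))
#descendants-suc d Λ c = length-concatMap-childrenFrom (descendants d) Λ c (suc (suc c))

All-concatMap⁺ : ∀ {A B : Set} {P : A → Set} {Q : B → Set} {f : A → List B} {xs} →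
                 (∀ {x} → P x → All Q (f x)) → All P xs → All Q (concatMap f xs)
All-concatMap⁺ P⇒Q ps = All.concat⁺ (All.map⁺ (All.map P⇒Q ps))

SemigroupOfGenus : ℕ → Node → Set
SemigroupOfGenus g (Λ , c) = NumSemigroup Λ c × gapsBelow Λ c ≡ g

descendants-genus : ∀ d {Λ c g} → NumSemigroup Λ c → gapsBelow Λ c ≡ g →
                    All (SemigroupOfGenus (d + g)) (descendants d (Λ , c))
descendants-genus zero    S gaps = (S , gaps) ∷ []
descendants-genus (suc d) {Λ} {c} {g} S gaps = All-concatMap⁺ grandchildren (childrenFrom-IsChild Λ c (suc (suc c)))
  where
  grandchildren : ∀ {w} → IsChild Λ c w → All (SemigroupOfGenus (suc d + g)) (descendants d w)
  grandchildren (child {x} c≤x gen) = subst (λ k → All (SemigroupOfGenus k) (descendants d (remove Λ x , suc x))) (+-suc d g)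
    (descendants-genus d (remove-generator S c≤x gen) (trans (genus-remove S c≤x) (cong suc gaps)))

AgreesBelow : ℕ → Subset → Node → Set
AgreesBelow c Λ w = ∀ {n} → n < c → proj₁ w n ≡ Λ n

descendants-agree : ∀ d Λ c → All (AgreesBelow c Λ) (descendants d (Λ , c))
descendants-agree zero    Λ c = (λ _ → refl) ∷ []
descendants-agree (suc d) Λ c = All-concatMap⁺ grandchildren (childrenFrom-IsChild Λ c (suc (suc c)))
  where
  grandchildren : ∀ {w} → IsChild Λ c w → All (AgreesBelow c Λ) (descendants d w)
  grandchildren (child {x} c≤x _) = All.map
    (λ agree {n} n<c → trans (agree (≤-trans n<c (m≤n⇒m≤1+n c≤x))) (remove-≢ (<⇒≢ (<-≤-trans n<c c≤x))))
    (descendants-agree d (remove Λ x) (suc x))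

Distinct : Node → Node → Set
Distinct w w' = ¬ proj₁ w ≐ proj₁ w'

-- Descendants of Λ ∖ {x₁} miss x₁, while those of a later sibling Λ ∖ {x₂} contain it.
descendants-distinct : ∀ d v → AllPairs Distinct (descendants d v)
descendants-distinct zero    v       = [] ∷ []
descendants-distinct (suc d) (Λ , c) =
  AllPairs.concat⁺ (All.map⁺ (All.universal (descendants-distinct d) (children (Λ , c))))
                   (AllPairs.map⁺ (AllPairs.map apart (childrenFrom-Siblings Λ c (suc (suc c)))))
  where
  apart : ∀ {w₁ w₂} → Siblings Λ w₁ w₂ → All (λ u → All (Distinct u) (descendants d w₂)) (descendants d w₁)
  apart (siblings {x₁} {x₂} x₁<x₂ (_ , x₁∈Λ , _)) = All.map
    (λ {u} u-agree → All.map
      (λ {u'} u'-agree u≐u' → ∈⇒¬∉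
         (trans (u'-agree (m<n⇒m<1+n x₁<x₂)) (trans (remove-≢ (<⇒≢ x₁<x₂)) x₁∈Λ))
         (trans (sym (u≐u' x₁)) (trans (u-agree ≤-refl) x∉remove)))
      (descendants-agree d (remove Λ x₂) (suc x₂)))
    (descendants-agree d (remove Λ x₁) (suc x₁))

root : Node
root = (λ _ → true) , 0

root-semigroup : NumSemigroup (λ _ → true) 0
root-semigroup = record { 0∈ = refl ; +-closed = λ _ _ → refl ; ≥c⇒∈ = λ _ → refl ; c-least = inj₁ refl }

descendants-suc⁺ : ∀ d v {Q : Node → Set} → Any (λ w → Any Q (children w)) (descendants d v) →
                   Any Q (descendants (suc d) v)
descendants-suc⁺ zero    v (here q) = Any.concatMap⁺ (λ w → w ∷ []) (Any.map here q)
descendants-suc⁺ (suc d) v q        =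
  Any.concatMap⁺ (descendants (suc d)) {xs = children v}
    (Any.map (λ {w} → descendants-suc⁺ d w) (Any.concatMap⁻ (descendants d) {xs = children v} q))

∈-insert⁻ : ∀ {Λ f n} → n ∈ insert Λ f → n ≡ f ⊎ n ∈ Λ
∈-insert⁻ {f = f} {n} n∈ with n ≟ f
... | yes n≡f = inj₁ n≡f
... | no  n≢f = inj₂ (trans (sym (insert-≢ n≢f)) n∈)

∈-insert-≥ : ∀ {Λ f n} → (∀ {n} → f < n → n ∈ Λ) → f ≤ n → n ∈ insert Λ f
∈-insert-≥ >f⇒∈ f≤n with m≤n⇒m<n∨m≡n f≤n
... | inj₁ f<n  = trans (insert-≢ (λ n≡f → <⇒≢ f<n (sym n≡f))) (>f⇒∈ f<n)
... | inj₂ refl = x∈insert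

insert-frobenius : ∀ {Λ f g} → IsNumericalSemigroup Λ → f ∉ Λ → (∀ {n} → f < n → n ∈ Λ) → gapsBelow Λ f ≡ g →
                   NumSemigroupOfGenus g (insert Λ f)
insert-frobenius {Λ} {f} (0∈Λ , closed , _) f∉Λ >f⇒∈ gaps =
  (trans (insert-≢ {Λ} 0≢f) 0∈Λ , closed' , f , λ _ → ∈-insert-≥ >f⇒∈) ,
  (f , (λ _ → ∈-insert-≥ >f⇒∈) , trans (gapsBelow-cong f (λ n<f → insert-≢ {Λ} (<⇒≢ n<f))) gaps)
  where
  0≢f : 0 ≢ f
  0≢f 0≡f = ∈⇒¬∉ 0∈Λ (subst (_∉ Λ) (sym 0≡f) f∉Λ)
  closed' : ∀ a b → a ∈ insert Λ f → b ∈ insert Λ f → a + b ∈ insert Λ f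
  closed' a b a∈ b∈ with ∈-insert⁻ {Λ} a∈ | ∈-insert⁻ {Λ} b∈
  ... | inj₁ refl | _         = ∈-insert-≥ >f⇒∈ (m≤m+n f b)
  ... | inj₂ _    | inj₁ refl = ∈-insert-≥ >f⇒∈ (m≤n+m f a)
  ... | inj₂ a∈Λ  | inj₂ b∈Λ  = trans (insert-≢ {Λ} (λ a+b≡f → ∈⇒¬∉ (closed a b a∈Λ b∈Λ) (subst (_∉ Λ) (sym a+b≡f) f∉Λ)))
                                      (closed a b a∈Λ b∈Λ)

-- both summands of a decomposition of f would be smaller than f, hence in Λ
frobenius-generator : ∀ {Λ Λ' f} → (∀ a b → a ∈ Λ → b ∈ Λ → a + b ∈ Λ) → f ∉ Λ → 0 < f →
                      insert Λ f ≐ Λ' → Generator Λ' f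
frobenius-generator {Λ} {Λ'} {f} closed f∉Λ 0<f insert≐Λ' =
  0<f , trans (sym (insert≐Λ' f)) (x∈insert {Λ}) , λ (decomposition {a} {b} 0<a 0<b a∈ b∈ a+b≡f) →
    ∈⇒¬∉ (subst (_∈ Λ) a+b≡f (closed a b (in-Λ a∈ (a+b≡f⇒a<f 0<b a+b≡f))
                                          (in-Λ b∈ (a+b≡f⇒a<f 0<a (trans (+-comm b a) a+b≡f)))))
         f∉Λ
  where
  a+b≡f⇒a<f : ∀ {a b} → 0 < b → a + b ≡ f → a < f
  a+b≡f⇒a<f {a} 0<b a+b≡f = subst (a <_) a+b≡f (m<m+n a 0<b)
  in-Λ : ∀ {n} → n ∈ Λ' → n < f → n ∈ Λ
  in-Λ {n} n∈ n<f = trans (sym (insert-≢ {Λ} (<⇒≢ n<f))) (trans (insert≐Λ' n) n∈)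

conductor≤frobenius : ∀ {Λ Λ' c f} → NumSemigroup Λ' c → f ∉ Λ → (∀ {n} → f < n → n ∈ Λ) →
                      insert Λ f ≐ Λ' → c ≤ f
conductor≤frobenius {Λ} {Λ'} {c} {f} S f∉Λ >f⇒∈ insert≐Λ' with c-least S
... | inj₁ refl = z≤n
... | inj₂ (c' , refl , c'∉Λ') with <-cmp c' f
...   | tri< c'<f _ _ = c'<f
...   | tri≈ _ refl _ = ⊥-elim (∈⇒¬∉ (trans (sym (insert≐Λ' f)) (x∈insert {Λ})) c'∉Λ')
...   | tri> _ _ f<c' = ⊥-elim (∈⇒¬∉ (trans (sym (insert≐Λ' c')) (∈-insert-≥ {Λ} >f⇒∈ (<⇒≤ f<c'))) c'∉Λ')

remove-insert : ∀ {Λ Λ' f} → f ∉ Λ → insert Λ f ≐ Λ' → Λ ≐ remove Λ' f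
remove-insert {Λ} {Λ'} {f} f∉Λ insert≐Λ' n with n ≟ f
... | yes refl = trans f∉Λ (sym (x∉remove {Λ'}))
... | no  n≢f  = trans (sym (insert-≢ {Λ} n≢f)) (trans (insert≐Λ' n) (sym (remove-≢ {Λ'} n≢f)))

Found : Subset → Node → Set
Found Λ w = Λ ≐ proj₁ w × NumSemigroup (proj₁ w) (proj₂ w)

-- Λ is the child, at its Frobenius number f, of the semigroup Λ ∪ {f} of genus one less.
descendants-complete : ∀ g {Λ} → NumSemigroupOfGenus g Λ → Any (Found Λ) (descendants g root)
descendants-complete zero {Λ} (_ , c , ≥c⇒∈ , no-gaps) = here (everything , root-semigroup)
  where
  everything : Λ ≐ (λ _ → true)
  everything n with n <? c
  ... | yes n<c = gapsBelow≡0⇒∈ c no-gaps n<c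
  ... | no  n≮c = ≥c⇒∈ n (≮⇒≥ n≮c)
descendants-complete (suc g) {Λ} (semigroup@(0∈Λ , closed , _) , c , ≥c⇒∈ , gaps)
  with frobenius (λ {n} → ≥c⇒∈ n) gaps
... | f , f∉Λ , >f⇒∈ , gaps-f =
  descendants-suc⁺ g root (Any.map parent (descendants-complete g (insert-frobenius semigroup f∉Λ >f⇒∈ gaps-f)))
  where
  0<f : 0 < f
  0<f = n≢0⇒n>0 (λ f≡0 → ∈⇒¬∉ 0∈Λ (subst (_∉ Λ) f≡0 f∉Λ))
  parent : ∀ {w} → Found (insert Λ f) w → Any (Found Λ) (children w)
  parent {Λ' , c'} (insert≐Λ' , S) =
    Any.map (λ { refl → remove-insert f∉Λ insert≐Λ' , remove-generator S c'≤f gen })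
            (childrenFrom-complete Λ' c' (suc (suc c')) c'≤f (generator< S gen) gen)
    where
    gen = frobenius-generator closed f∉Λ 0<f insert≐Λ'
    c'≤f = conductor≤frobenius S f∉Λ >f⇒∈ insert≐Λ'

-- Counting descendants

generators-window : ∀ {Λ c x} E → NumSemigroup Λ c → c + suc (suc c) ≤ E → E ≤ suc x + suc (suc (suc x)) →
                    count (generator? Λ) (suc x) (E ∸ suc x) ≡ #generators≥ Λ (suc x)
generators-window {Λ} {c} {x} E S 2c+2≤E E≤2x+4 = sym (count-cut (generator? Λ) (suc x) beyond window≤)
  where
  beyond : ∀ y → suc x + (E ∸ suc x) ≤ y → ¬ Generator Λ y
  beyond y le gen = <⇒≱ (generator< S gen) (≤-trans 2c+2≤E (≤-trans (m≤n+m∸n E (suc x)) le))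
  window≤ : E ∸ suc x ≤ suc (suc (suc x))
  window≤ = ≤-trans (∸-monoˡ-≤ (suc x) E≤2x+4) (≤-reflexive (m+n∸m≡n (suc x) _))

generators-window-conductor : ∀ {Λ c x} → NumSemigroup Λ c → c ≤ x →
  count (generator? Λ) (suc x) (c + suc (suc c) ∸ suc x) ≡ #generators≥ Λ (suc x)
generators-window-conductor S c≤x =
  generators-window _ S ≤-refl (+-mono-≤ (m≤n⇒m≤1+n c≤x) (s≤s (s≤s (m≤n⇒m≤1+n c≤x))))

generators-remove-≥ : ∀ Λ x → #generators≥ Λ (suc x) ≤ #generators≥ (remove Λ x) (suc x)
generators-remove-≥ Λ x = count-mono-≤ (generator? Λ) (generator? (remove Λ x)) (suc x) (suc (suc (suc x)))
  (λ y x<y gen → generator-remove gen (λ y≡x → <⇒≢ x<y (sym y≡x)))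

generators-remove-≤ : ∀ {Λ c m x} → NumSemigroup Λ c → c ≤ x → Multiplicity Λ m → m ≢ x →
                      #generators≥ (remove Λ x) (suc x) ≤ suc (#generators≥ Λ (suc x))
generators-remove-≤ {Λ} {m = m} {x} S c≤x M m≢x =
  count-≤-suc (generator? (remove Λ x)) (generator? Λ) (x + m) (suc x) (suc (suc (suc x)))
    (λ y _ gen → generator-of-remove S c≤x M m≢x gen)

descendants-LB : ∀ d {Λ c} → NumSemigroup Λ c → descLB (#generators≥ Λ c) d ≤ length (descendants d (Λ , c))
descendants-LB zero    S = ≤-refl
descendants-LB (suc d) {Λ} {c} S =
  ≤-trans (sumBelow≤sumWhere (generator? Λ) c (suc (suc c)) child-LB) (≤-reflexive (sym (#descendants-suc d Λ c)))
  where
  child-LB : ∀ x → c ≤ x → Generator Λ x →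
             descLB (count (generator? Λ) (suc x) (c + suc (suc c) ∸ suc x)) d ≤ length (descendants d (remove Λ x , suc x))
  child-LB x c≤x gen = begin
    descLB (count (generator? Λ) (suc x) (c + suc (suc c) ∸ suc x)) d ≡⟨ cong (λ k → descLB k d) (generators-window-conductor S c≤x) ⟩
    descLB (#generators≥ Λ (suc x)) d                                 ≤⟨ descLB-mono-≤ d (generators-remove-≥ Λ x) ⟩
    descLB (#generators≥ (remove Λ x) (suc x)) d                      ≤⟨ descendants-LB d (remove-generator S c≤x gen) ⟩
    length (descendants d (remove Λ x , suc x))                       ∎
    where open ≤-Reasoning

descendants-UB : ∀ d {Λ c m} → NumSemigroup Λ c → Multiplicity Λ m → m < c →
                 length (descendants d (Λ , c)) ≤ descUB (#generators≥ Λ c) d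
descendants-UB zero    S M m<c = ≤-refl
descendants-UB (suc d) {Λ} {c} {m} S M m<c =
  ≤-trans (≤-reflexive (#descendants-suc d Λ c)) (sumWhere≤sumBelow (generator? Λ) c (suc (suc c)) child-UB)
  where
  child-UB : ∀ x → c ≤ x → Generator Λ x →
             length (descendants d (remove Λ x , suc x)) ≤ descUB (suc (count (generator? Λ) (suc x) (c + suc (suc c) ∸ suc x))) d
  child-UB x c≤x gen = begin
    length (descendants d (remove Λ x , suc x))
      ≤⟨ descendants-UB d (remove-generator S c≤x gen) (multiplicity-remove M m≢x) (m<n⇒m<1+n m<x) ⟩
    descUB (#generators≥ (remove Λ x) (suc x)) d
      ≤⟨ descUB-mono-≤ d (generators-remove-≤ S c≤x M m≢x) ⟩
    descUB (suc (#generators≥ Λ (suc x))) d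
      ≡⟨ cong (λ k → descUB (suc k) d) (sym (generators-window-conductor S c≤x)) ⟩
    descUB (suc (count (generator? Λ) (suc x) (c + suc (suc c) ∸ suc x))) d ∎
    where
    open ≤-Reasoning
    m<x = <-≤-trans m<c c≤x
    m≢x = <⇒≢ m<x

-- Ordinary semigroups

-- the ordinary semigroup {0} ∪ [h + 2, ∞), of genus h + 1
record Ordinary (h : ℕ) (Λ : Subset) : Set where
  field
    zero∈  : 0 ∈ Λ
    small∉ : ∀ {n} → 0 < n → n < suc (suc h) → n ∉ Λ
    large∈ : ∀ {n} → suc (suc h) ≤ n → n ∈ Λ

module OrdinarySemigroup {h Λ} (O : Ordinary h Λ) where

  open Ordinary O

  c : ℕ
  c = suc (suc h)

  positive⇒≥c : ∀ {n} → 0 < n → n ∈ Λ → c ≤ n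
  positive⇒≥c {n} 0<n n∈Λ with n <? c
  ... | yes n<c = contradiction (small∉ 0<n n<c) (∈⇒¬∉ n∈Λ)
  ... | no  n≮c = ≮⇒≥ n≮c

  semigroup : NumSemigroup Λ c
  semigroup = record
    { 0∈       = zero∈
    ; +-closed = closed
    ; ≥c⇒∈     = large∈
    ; c-least  = inj₂ (suc h , refl , small∉ z<s ≤-refl)
    }
    where
    closed : ∀ {a b} → a ∈ Λ → b ∈ Λ → a + b ∈ Λ
    closed {zero}  {b}     _   b∈Λ = b∈Λ
    closed {suc a} {zero}  a∈Λ _   = subst (_∈ Λ) (sym (+-identityʳ (suc a))) a∈Λ
    closed {suc a} {suc b} a∈Λ _   = large∈ (≤-trans (positive⇒≥c z<s a∈Λ) (m≤m+n (suc a) (suc b)))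

  multiplicity : Multiplicity Λ c
  multiplicity = z<s , large∈ ≤-refl , positive⇒≥c

  generator-below-2c : ∀ {y} → c ≤ y → y < c + c → Generator Λ y
  generator-below-2c c≤y y<2c = <-≤-trans z<s c≤y , large∈ c≤y , λ (decomposition 0<a 0<b a∈Λ b∈Λ a+b≡y) →
    <⇒≱ y<2c (subst (c + c ≤_) a+b≡y (+-mono-≤ (positive⇒≥c 0<a a∈Λ) (positive⇒≥c 0<b b∈Λ)))

  no-generator-above-2c : ∀ {y} → c + c ≤ y → ¬ Generator Λ y
  no-generator-above-2c {y} 2c≤y (_ , _ , indecomposable) =
    indecomposable (decomposition z<s (<-≤-trans z<s c≤y-c) (large∈ ≤-refl) (large∈ c≤y-c) (m+[n∸m]≡n (≤-trans (m≤m+n c c) 2c≤y)))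
    where
    c≤y-c : c ≤ y ∸ c
    c≤y-c = subst (_≤ y ∸ c) (m+n∸m≡n c c) (∸-monoˡ-≤ c 2c≤y)

  -- the generators ≥ c + 2 are c + 2, …, 2c − 1
  generators-tail : ∀ n → h ≤ n → count (generator? Λ) (suc (suc c)) n ≡ h
  generators-tail n h≤n = trans (count-cut (generator? Λ) (suc (suc c)) beyond h≤n)
                                (count-all (generator? Λ) (suc (suc c)) h between)
    where
    2c≡c+2+h : c + c ≡ suc (suc c) + h
    2c≡c+2+h = trans (+-suc c (suc h)) (cong suc (+-suc c h))
    beyond : ∀ y → suc (suc c) + h ≤ y → ¬ Generator Λ y
    beyond y le = no-generator-above-2c (subst (_≤ y) (sym 2c≡c+2+h) le)
    between : ∀ y → suc (suc c) ≤ y → y < suc (suc c) + h → Generator Λ y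
    between y c+2≤y y< = generator-below-2c (≤-trans (n≤1+n c) (≤-trans (n≤1+n (suc c)) c+2≤y))
                                            (subst (y <_) (sym 2c≡c+2+h) y<)

  remove-c : Ordinary (suc h) (remove Λ c)
  remove-c = record
    { zero∈  = trans (remove-≢ (λ ())) zero∈
    ; small∉ = small
    ; large∈ = λ c<n → trans (remove-≢ (λ n≡c → <⇒≢ c<n (sym n≡c))) (large∈ (<⇒≤ c<n))
    }
    where
    small : ∀ {n} → 0 < n → n < suc c → n ∉ remove Λ c
    small {n} 0<n n<1+c with n ≟ c
    ... | yes refl = x∉remove
    ... | no  n≢c  = trans (remove-≢ n≢c) (small∉ 0<n (≤∧≢⇒< (≤-pred n<1+c) n≢c))

  c≤c+2 : c ≤ suc (suc c)
  c≤c+2 = ≤-trans (n≤1+n c) (n≤1+n (suc c))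

  generator-c : Generator Λ c
  generator-c = generator-below-2c ≤-refl (m<m+n c z<s)

  generator-c+1 : Generator Λ (suc c)
  generator-c+1 = generator-below-2c (n≤1+n c) (subst (_≤ c + c) (+-comm c 2) (+-monoʳ-≤ c (s≤s (s≤s z≤n))))

  -- x + c = (c + 1) + (x − 1) stays decomposable, so removing x ≥ c + 2 creates no new generator
  generators-remove-large : ∀ {x} → suc (suc c) ≤ x → #generators≥ (remove Λ x) (suc x) ≤ #generators≥ Λ (suc x)
  generators-remove-large {suc x} c+2≤x =
    count-mono-≤ (generator? (remove Λ (suc x))) (generator? Λ) (suc (suc x)) (suc (suc (suc (suc x)))) old
    where
    c<x : c < x
    c<x = ≤-pred c+2≤x
    old : ∀ y → suc (suc x) ≤ y → Generator (remove Λ (suc x)) y → Generator Λ y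
    old y _ gen@(_ , _ , indecomposable) with generator-of-remove semigroup (<⇒≤ (m<n⇒m<1+n c<x)) multiplicity
                                                 (<⇒≢ (m<n⇒m<1+n c<x)) gen
    ... | inj₁ gen-Λ = gen-Λ
    ... | inj₂ y≡x+c = contradiction
      (decomposition z<s (<-≤-trans z<s c<x)
        (trans (remove-≢ (λ c+1≡x+1 → <⇒≢ c<x (suc-injective c+1≡x+1))) (large∈ (n≤1+n c)))
        (trans (remove-≢ (λ x≡1+x → <⇒≢ (n<1+n x) x≡1+x)) (large∈ (<⇒≤ c<x)))
        (trans (cong suc (+-comm c x)) (sym y≡x+c)))
      indecomposable

  new-generator : Generator (remove Λ (suc c)) (suc c + c)
  new-generator = z<s , trans (remove-≢ 2c+1≢c+1) (large∈ (≤-trans (n≤1+n c) (m≤m+n (suc c) c))) , indecomposable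
    where
    2c+1≢c+1 : suc c + c ≢ suc c
    2c+1≢c+1 2c+1≡c+1 = <⇒≢ (m<m+n (suc c) z<s) (sym 2c+1≡c+1)
    indecomposable : ¬ Decomposition (remove Λ (suc c)) (suc c + c)
    indecomposable (decomposition {a} {b} 0<a 0<b a∈ b∈ a+b≡2c+1)
      with ∈-remove⁻ a∈ | ∈-remove⁻ b∈ | <-cmp a (suc c)
    ... | _ , a≢c+1 | _         | tri≈ _ a≡c+1 _ = a≢c+1 a≡c+1
    ... | a∈Λ , _   | _ , b≢c+1 | tri< a<c+1 _ _ = b≢c+1 (+-cancelˡ-≡ c b (suc c) c+b≡c+c+1)
      where
      a≡c : a ≡ c
      a≡c = ≤-antisym (≤-pred a<c+1) (positive⇒≥c 0<a a∈Λ)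
      c+b≡c+c+1 : c + b ≡ c + suc c
      c+b≡c+c+1 = trans (cong (_+ b) (sym a≡c)) (trans a+b≡2c+1 (sym (+-suc c c)))
    ... | _         | b∈Λ , _   | tri> _ _ c+1<a =
      <-irrefl (sym a+b≡2c+1) (+-mono-≤ c+1<a (positive⇒≥c 0<b b∈Λ))

  generators-remove-c+1-≥ : suc h ≤ #generators≥ (remove Λ (suc c)) (suc (suc c))
  generators-remove-c+1-≥ = subst (_< #generators≥ (remove Λ (suc c)) (suc (suc c)))
    (generators-tail (suc (suc (suc (suc c)))) (≤-trans (n≤1+n h) (m≤n+m (suc h) 5)))
    (count-<-witness (generator? Λ) (generator? (remove Λ (suc c))) (suc c + c) (suc (suc c)) (suc (suc (suc (suc c))))
      (λ y c+1<y gen → generator-remove gen (λ y≡c+1 → <⇒≢ c+1<y (sym y≡c+1)))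
      (s≤s (subst (_≤ c + c) (+-comm c 1) (+-monoʳ-≤ c z<s)))
      (s≤s (s≤s (+-monoʳ-≤ c (m≤n+m c 4))))
      (no-generator-above-2c (n≤1+n (c + c)))
      new-generator)

  generators-remove-c+1-≤ : #generators≥ (remove Λ (suc c)) (suc (suc c)) ≤ suc h
  generators-remove-c+1-≤ = subst (λ k → #generators≥ (remove Λ (suc c)) (suc (suc c)) ≤ suc k)
    (generators-tail (suc (suc (suc (suc c)))) (≤-trans (n≤1+n h) (m≤n+m (suc h) 5)))
    (generators-remove-≤ semigroup (n≤1+n c) multiplicity (<⇒≢ (n<1+n c)))

  #descendants-child : ℕ → ℕ → ℕ
  #descendants-child d x = length (descendants d (remove Λ x , suc x))

  #descendants-ordinary : ∀ d → length (descendants (suc d) (Λ , c)) ≡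
    #descendants-child d c + (#descendants-child d (suc c) + sumWhere (generator? Λ) (suc (suc c)) c (#descendants-child d))
  #descendants-ordinary d = trans (#descendants-suc d Λ c)
    (trans (sumWhere-yes (generator? Λ) (suc c) (#descendants-child d) generator-c)
           (cong (#descendants-child d c +_) (sumWhere-yes (generator? Λ) c (#descendants-child d) generator-c+1)))

  window-later : ∀ {x} → suc (suc c) ≤ x →
                 count (generator? Λ) (suc x) (suc (suc c) + c ∸ suc x) ≡ #generators≥ Λ (suc x)
  window-later c+2≤x = generators-window _ semigroup (≤-reflexive (+-comm c (suc (suc c))))
    (+-mono-≤ (m≤n⇒m≤1+n c+2≤x) (≤-trans (≤-trans c≤c+2 c+2≤x) (m≤n+m _ 3)))

  child-c+1-UB : ∀ d → #descendants-child d (suc c) ≤ descUB (suc h) d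
  child-c+1-UB d = ≤-trans
    (descendants-UB d (remove-generator semigroup (n≤1+n c) generator-c+1)
                      (multiplicity-remove multiplicity (<⇒≢ (n<1+n c))) (m<n⇒m<1+n (n<1+n c)))
    (descUB-mono-≤ d generators-remove-c+1-≤)

  child-c+1-LB : ∀ d → descLB (suc h) d ≤ #descendants-child d (suc c)
  child-c+1-LB d = ≤-trans (descLB-mono-≤ d generators-remove-c+1-≥)
                           (descendants-LB d (remove-generator semigroup (n≤1+n c) generator-c+1))

  later-children-UB : ∀ d → sumWhere (generator? Λ) (suc (suc c)) c (#descendants-child d) ≤ sumBelow (λ j → descUB j d) h
  later-children-UB d = ≤-trans (sumWhere≤sumBelow (generator? Λ) (suc (suc c)) c child-UB)
                                (≤-reflexive (cong (sumBelow (λ j → descUB j d)) (generators-tail c (m≤n+m h 2))))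
    where
    child-UB : ∀ x → suc (suc c) ≤ x → Generator Λ x →
               #descendants-child d x ≤ descUB (count (generator? Λ) (suc x) (suc (suc c) + c ∸ suc x)) d
    child-UB x c+2≤x gen = begin
      #descendants-child d x
        ≤⟨ descendants-UB d (remove-generator semigroup c≤x gen) (multiplicity-remove multiplicity (<⇒≢ c<x)) (m<n⇒m<1+n c<x) ⟩
      descUB (#generators≥ (remove Λ x) (suc x)) d
        ≤⟨ descUB-mono-≤ d (generators-remove-large c+2≤x) ⟩
      descUB (#generators≥ Λ (suc x)) d
        ≡⟨ cong (λ k → descUB k d) (sym (window-later c+2≤x)) ⟩
      descUB (count (generator? Λ) (suc x) (suc (suc c) + c ∸ suc x)) d ∎
      where
      open ≤-Reasoning
      c<x = <-≤-trans (n<1+n c) (≤-trans (n≤1+n (suc c)) c+2≤x)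
      c≤x = <⇒≤ c<x

  later-children-LB : ∀ d → sumBelow (λ j → descLB j d) h ≤ sumWhere (generator? Λ) (suc (suc c)) c (#descendants-child d)
  later-children-LB d = ≤-trans (≤-reflexive (cong (sumBelow (λ j → descLB j d)) (sym (generators-tail c (m≤n+m h 2)))))
                                (sumBelow≤sumWhere (generator? Λ) (suc (suc c)) c child-LB)
    where
    child-LB : ∀ x → suc (suc c) ≤ x → Generator Λ x →
               descLB (count (generator? Λ) (suc x) (suc (suc c) + c ∸ suc x)) d ≤ #descendants-child d x
    child-LB x c+2≤x gen = begin
      descLB (count (generator? Λ) (suc x) (suc (suc c) + c ∸ suc x)) d ≡⟨ cong (λ k → descLB k d) (window-later c+2≤x) ⟩
      descLB (#generators≥ Λ (suc x)) d                                 ≤⟨ descLB-mono-≤ d (generators-remove-≥ Λ x) ⟩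
      descLB (#generators≥ (remove Λ x) (suc x)) d                      ≤⟨ descendants-LB d (remove-generator semigroup c≤x gen) ⟩
      #descendants-child d x                                            ∎
      where
      open ≤-Reasoning
      c≤x = ≤-trans c≤c+2 c+2≤x

descendants-ordinary-UB : ∀ d {h Λ} → Ordinary h Λ →
                          length (descendants d (Λ , suc (suc h))) ≤ ordinaryDesc ordinaryStepUB h d
descendants-ordinary-UB zero    O = ≤-refl
descendants-ordinary-UB (suc d) O = ≤-trans (≤-reflexive (#descendants-ordinary d))
  (+-mono-≤ (descendants-ordinary-UB d remove-c) (+-mono-≤ (child-c+1-UB d) (later-children-UB d)))
  where open OrdinarySemigroup O

descendants-ordinary-LB : ∀ d {h Λ} → Ordinary h Λ →
                          ordinaryDesc ordinaryStepLB h d ≤ length (descendants d (Λ , suc (suc h)))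
descendants-ordinary-LB zero    O = ≤-refl
descendants-ordinary-LB (suc d) O = ≤-trans
  (+-mono-≤ (descendants-ordinary-LB d remove-c) (+-mono-≤ (child-c+1-LB d) (later-children-LB d)))
  (≤-reflexive (sym (#descendants-ordinary d)))
  where open OrdinarySemigroup O

ℕ∖1 : Subset
ℕ∖1 = remove (λ _ → true) 1

ℕ∖1-ordinary : Ordinary 0 ℕ∖1
ℕ∖1-ordinary = record
  { zero∈  = remove-≢ (λ ())
  ; small∉ = λ { {suc zero} _ _ → x∉remove ; {suc (suc _)} _ (s≤s (s≤s ())) }
  ; large∈ = λ { {suc (suc _)} _ → remove-≢ (λ ()) ; {suc zero} (s≤s ()) }
  }

-- ℕ₀ has the single child ℕ₀ ∖ {1}, by computation of its generators below 2.
#descendants-root : ∀ d → length (descendants (suc d) root) ≡ length (descendants d (ℕ∖1 , 2))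
#descendants-root d = cong length (++-identityʳ (descendants d (ℕ∖1 , 2)))

numSemigroupOfGenus : ∀ {g} w → SemigroupOfGenus (g + 0) w → NumSemigroupOfGenus g (proj₁ w)
numSemigroupOfGenus {g} (Λ , c) (S , gaps) =
  (0∈ S , (λ _ _ → +-closed S) , c , (λ _ → ≥c⇒∈ S)) , c , (λ _ → ≥c⇒∈ S) , trans gaps (+-identityʳ g)

count-of-genus : ∀ g → CountOfGenus g (length (descendants g root))
count-of-genus g =
  map proj₁ (descendants g root) ,
  length-map proj₁ (descendants g root) ,
  All.map⁺ (All.map (λ {w} → numSemigroupOfGenus w) (descendants-genus g root-semigroup refl)) ,
  AllPairs.map⁺ (descendants-distinct g root) ,
  λ Λ ns → Any.map⁺ (Any.map proj₁ (descendants-complete g ns))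

theorem5 : (g : ℕ) → Σ ℕ λ n →
             CountOfGenus g n
             × (2 ≤ g → 2 * fib g ≤ n)
             × (3 ≤ g → n ≤ 1 + 3 * 2 ^ (g ∸ 3))
theorem5 g = length (descendants g root) , count-of-genus g , lower g , upper g
  where
  lower : ∀ g → 2 ≤ g → 2 * fib g ≤ length (descendants g root)
  lower (suc zero) (s≤s ())
  lower (suc (suc n)) _ = begin
    2 * fib (suc (suc n))                                ≡⟨ ordinaryDescLB-closed n ⟨
    ordinaryDesc ordinaryStepLB 0 (suc n)                ≤⟨ descendants-ordinary-LB (suc n) ℕ∖1-ordinary ⟩
    length (descendants (suc n) (ℕ∖1 , 2))               ≡⟨ #descendants-root (suc n) ⟨
    length (descendants (suc (suc n)) root)              ∎
    where open ≤-Reasoning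
  upper : ∀ g → 3 ≤ g → length (descendants g root) ≤ 1 + 3 * 2 ^ (g ∸ 3)
  upper (suc zero)       (s≤s ())
  upper (suc (suc zero)) (s≤s (s≤s ()))
  upper (suc (suc (suc m))) _ = begin
    length (descendants (suc (suc (suc m))) root)        ≡⟨ #descendants-root (suc (suc m)) ⟩
    length (descendants (suc (suc m)) (ℕ∖1 , 2))         ≤⟨ descendants-ordinary-UB (suc (suc m)) ℕ∖1-ordinary ⟩
    ordinaryDesc ordinaryStepUB 0 (suc (suc m))          ≡⟨ ordinaryDescUB-closed m ⟩
    1 + 3 * 2 ^ m                                        ∎
    where open ≤-Reasoning
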